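{- Let $r$ be a balanced rotor type and let $a\ge 0$, $b\ge 1$ be integers such that the runs $r^{(1)},\dots,r^{(2a)}$ and $r^{(2a+1)},\dots,r^{(2a+2b)}$ are balanced. Let $S_{UU}$ and $S_{DD}$ be the runs of the hitting sequences $UU(r)$ and $DD(r)$, respectively, formed by the targets hit by the $(2a+1)$-th through $(2a+2b)$-th particles to leave the source. If the run $r^{(a+1)},\dots,r^{(a+b)}$ is not constant, then $S_{UU}$ and $S_{DD}$ are both nonempty and balanced and their lengths add to $2b$. If the run $r^{(a+1)},\dots,r^{(a+b)}$ is constant, then exactly one of $S_{UU}$, $S_{DD}$ is nonempty, and it is balanced of length exactly $2b$.
   Context: A two-state rotor type is an infinite periodic sequence $r=(r^{(1)},r^{(2)},\dots)$ over $\{1,2\}$ (convention $r^{(1)}=1$); it is balanced if $1$ and $2$ occur equally often in a period. A run is a contiguous finite subsequence; a run is balanced if it contains equally many of each of the two states, and constant if all its terms are equal. Rotor-router dynamics: at each non-target vertex $v$ there is a periodic sequence $e_v^{(1)},e_v^{(2)},\dots$ of out-edges; a particle starts at the source, on its $j$-th visit to $v$ leaves along $e_v^{(j)}$, and whenever it reaches a target it is returned to the source; the hitting sequence is the sequence of targets reached. The particle is regarded as a new particle each time it leaves the source, so the $k$-th particle is the one leaving the source along the edge given by the $k$-th term of the source rotor. The compressor for $r$ has non-target vertices $1$ (source), $2,3$ and targets $4,5$. On the $j$-th departure: from vertex $1$ the particle goes to vertex $2$ if $r^{(j)}=1$ and to vertex $3$ if $r^{(j)}=2$; from vertex $2$,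 in variant $U$ it goes to vertex $1$ if $r^{(j)}=1$ and to target $4$ if $r^{(j)}=2$, in variant $D$ to target $4$ if $r^{(j)}=1$ and to vertex $1$ if $r^{(j)}=2$; from vertex $3$ likewise with target $5$. $UU(r)$ (resp. $DD(r)$) is the hitting sequence with variant $U$ (resp. $D$) at both vertices $2$ and $3$; a run of it is balanced if it contains equally many $4$'s and $5$'s. -}

module Defs where

open import Data.Nat using (ℕ; zero; suc; _+_; _<_)
open import Data.Product using (_×_; _,_; proj₁; proj₂; Σ)
open import Data.Maybe using (Maybe; just; nothing)
open import Data.List using (List; []; _∷_; applyUpTo; mapMaybe)
open import Data.List.Relation.Unary.All using (All)
open import Relation.Binary.PropositionalEquality using (_≡_)

data St : Set where
  one two : St

-- A two-state rotor type: an infinite periodic sequence over {1,2}.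
-- Indexing is 0-based: seq k is r^(k+1).
record RotorType : Set where
  field
    seq      : ℕ → St
    period   : ℕ
    period>0 : 0 < period
    periodic : ∀ k → seq (k + period) ≡ seq k
    first    : seq 0 ≡ one

open RotorType public

count₁ count₂ : List St → ℕ
count₁ []          = 0
count₁ (one ∷ xs)  = suc (count₁ xs)
count₁ (two ∷ xs)  = count₁ xs
count₂ []          = 0
count₂ (one ∷ xs)  = count₂ xs
count₂ (two ∷ xs)  = suc (count₂ xs)

-- run r^(s+1), ..., r^(s+len)  (0-based start s)
run : RotorType → ℕ → ℕ → List St
run r s len = applyUpTo (λ i → seq r (s + i)) len

BalancedRun : List St → Set
BalancedRun l = count₁ l ≡ count₂ l

ConstantRun : List St → Set
ConstantRun l = Σ St (λ s → All (_≡ s) l)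

BalancedType : RotorType → Set
BalancedType r = BalancedRun (run r 0 (period r))

data Target : Set where
  t4 t5 : Target

data Variant : Set where
  U D : Variant

-- does the particle leaving vertex 2/3 with rotor value s go to the target?
toTarget : Variant → St → Maybe Target → Maybe Target
toTarget U one t = nothing   -- back to source
toTarget U two t = t
toTarget D one t = t
toTarget D two t = nothing

-- Counters: number of previous departures from vertex 2 and vertex 3.
Counters : Set
Counters = ℕ × ℕ

-- The k-th particle (0-based; it leaves the source on the (k+1)-th departure,
-- using source rotor value seq r k), given the departure counters of vertices
-- 2 and 3 so far. Returns the target hit by this particle (nothing if it
-- returns to the source, where it becomes a new particle) and the new counters.
particle : RotorType → Variant → Counters → ℕ → Maybe Target × Counters
particle r v (c2 , c3) k with seq r k
... | one = toTarget v (seq r c2) (just t4) , (suc c2 , c3)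
... | two = toTarget v (seq r c3) (just t5) , (c2 , suc c3)

countersBefore : RotorType → Variant → ℕ → Counters
countersBefore r v zero    = (0 , 0)
countersBefore r v (suc k) = proj₂ (particle r v (countersBefore r v k) k)

hit : RotorType → Variant → ℕ → Maybe Target
hit r v k = proj₁ (particle r v (countersBefore r v k) k)

-- run of the hitting sequence (variant v at both vertices 2 and 3) formed by
-- the targets hit by the (s+1)-th through (s+len)-th particles
hitRun : RotorType → Variant → ℕ → ℕ → List Target
hitRun r v s len = mapMaybe (hit r v) (applyUpTo (λ i → s + i) len)

count4 count5 : List Target → ℕ
count4 []         = 0
count4 (t4 ∷ xs)  = suc (count4 xs)
count4 (t5 ∷ xs)  = count4 xs
count5 []         = 0
count5 (t4 ∷ xs)  = count5 xs
count5 (t5 ∷ xs)  = suc (count5 xs)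

BalancedHits : List Target → Set
BalancedHits l = count4 l ≡ count5 l

-- Write N_s(k) for the number of s among r^(1), ..., r^(k). Before the k-th particle leaves
-- the source, vertex 2 has been left N_1(k) times and vertex 3 N_2(k) times, so in variant U
-- the number of 4's hit so far is N_2(N_1(k)) and of 5's is N_2(N_2(k)); in variant D the outer
-- N_2 becomes N_1. The two balanced runs force N_1 = N_2 = a after 2a terms and = a + b after
-- 2a + 2b terms, so among particles 2a+1, ..., 2a+2b variant U hits each target as often as
-- r^(a+1), ..., r^(a+b) contains a 2, and variant D as often as it contains a 1. Both cases of
-- the theorem are read off from this.

module Submission where

open import Defs
open import Data.Nat using (ℕ; zero; suc; _+_; _*_; _≤_; _≥_)
open import Data.Nat.Properties
  using (+-identityʳ; +-suc; +-assoc; +-comm; +-cancelʳ-≡; *-cancelˡ-≡; *-distribˡ-+; m<n⇒n≢0)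
open import Function using (_∘_)
open import Data.Product using (_×_; _,_; proj₁; proj₂)
open import Data.Sum using (_⊎_; inj₁; inj₂)
open import Data.Maybe using (just; nothing)
open import Data.List using (List; []; _∷_; [_]; length; applyUpTo; mapMaybe; fromMaybe)
open import Data.List.Properties using (length-applyUpTo)
open import Data.List.Relation.Unary.All using (All; []; _∷_)
open import Relation.Nullary using (¬_)
open import Relation.Binary.PropositionalEquality
  using (_≡_; _≢_; refl; sym; trans; cong; cong₂; subst; module ≡-Reasoning)

open ≡-Reasoning

count : St → List St → ℕ
count one = count₁
count two = count₂

countHits : Target → List Target → ℕ
countHits t4 = count4
countHits t5 = count5

flip : St → St
flip one = two
flip two = one

count-[] : ∀ s → count s [] ≡ 0
count-[] one = refl
count-[] two = refl

count-∷ : ∀ s x xs → count s (x ∷ xs) ≡ count s [ x ] + count s xs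
count-∷ one one xs = refl
count-∷ one two xs = refl
count-∷ two one xs = refl
count-∷ two two xs = refl

count₁+count₂≡length : ∀ xs → count₁ xs + count₂ xs ≡ length xs
count₁+count₂≡length []         = refl
count₁+count₂≡length (one ∷ xs) = cong suc (count₁+count₂≡length xs)
count₁+count₂≡length (two ∷ xs) =
  trans (+-suc (count₁ xs) (count₂ xs)) (cong suc (count₁+count₂≡length xs))

count-flip-All : ∀ s {xs} → All (_≡ s) xs → count (flip s) xs ≡ 0
count-flip-All one       []         = refl
count-flip-All two       []         = refl
count-flip-All one {one ∷ _} (refl ∷ p) = count-flip-All one p
count-flip-All two {two ∷ _} (refl ∷ p) = count-flip-All two p

count-All : ∀ s {xs} → All (_≡ s) xs → count s xs ≡ length xs
count-All one       []         = refl
count-All two       []         = refl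
count-All one {one ∷ _} (refl ∷ p) = cong suc (count-All one p)
count-All two {two ∷ _} (refl ∷ p) = cong suc (count-All two p)

All-count-flip : ∀ s xs → count (flip s) xs ≡ 0 → All (_≡ s) xs
All-count-flip s   []         _ = []
All-count-flip one (one ∷ xs) e = refl ∷ All-count-flip one xs e
All-count-flip two (two ∷ xs) e = refl ∷ All-count-flip two xs e

countHits-[] : ∀ t → countHits t [] ≡ 0
countHits-[] t4 = refl
countHits-[] t5 = refl

countHits-mapMaybe-∷ : ∀ {A : Set} t (g : A → _) x xs →
  countHits t (mapMaybe g (x ∷ xs)) ≡ countHits t (fromMaybe (g x)) + countHits t (mapMaybe g xs)
countHits-mapMaybe-∷ t g x xs with g x
countHits-mapMaybe-∷ t4 g x xs | nothing = refl
countHits-mapMaybe-∷ t5 g x xs | nothing = refl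
countHits-mapMaybe-∷ t4 g x xs | just t4 = refl
countHits-mapMaybe-∷ t4 g x xs | just t5 = refl
countHits-mapMaybe-∷ t5 g x xs | just t4 = refl
countHits-mapMaybe-∷ t5 g x xs | just t5 = refl

count4+count5≡length : ∀ ts → count4 ts + count5 ts ≡ length ts
count4+count5≡length []        = refl
count4+count5≡length (t4 ∷ ts) = cong suc (count4+count5≡length ts)
count4+count5≡length (t5 ∷ ts) =
  trans (+-suc (count4 ts) (count5 ts)) (cong suc (count4+count5≡length ts))

balancedHits-length : ∀ ts {n} → count4 ts ≡ n → count5 ts ≡ n → BalancedHits ts × length ts ≡ 2 * n
balancedHits-length ts {n} e₄ e₅ =
  trans e₄ (sym e₅) ,
  trans (sym (count4+count5≡length ts)) (trans (cong₂ _+_ e₄ e₅) (cong (n +_) (sym (+-identityʳ n))))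

nonempty-of-length : ∀ {A : Set} {xs : List A} {n} → length xs ≡ 2 * n → n ≢ 0 → xs ≢ []
nonempty-of-length {n = zero}  _  n≢0 _    = n≢0 refl
nonempty-of-length {n = suc n} () _   refl

empty-of-length : ∀ {A : Set} {xs : List A} {n} → length xs ≡ 2 * n → n ≡ 0 → xs ≡ []
empty-of-length {xs = []}    _ _    = refl
empty-of-length {xs = _ ∷ _} () refl

module Telescope {A : Set} (size : List A → ℕ) (weight : A → ℕ)
                 (size-[] : size [] ≡ 0)
                 (size-∷ : ∀ x xs → size (x ∷ xs) ≡ weight x + size xs) where

  telescope : (f : ℕ → A) (F : ℕ → ℕ) → (∀ k → weight (f k) + F k ≡ F (suc k)) →
              ∀ m → size (applyUpTo f m) + F 0 ≡ F m
  telescope f F step zero    = cong (_+ F 0) size-[]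
  telescope f F step (suc m) = begin
    size (f 0 ∷ applyUpTo (f ∘ suc) m) + F 0       ≡⟨ cong (_+ F 0) (size-∷ (f 0) _) ⟩
    (weight (f 0) + size (applyUpTo (f ∘ suc) m)) + F 0
      ≡⟨ cong (_+ F 0) (+-comm (weight (f 0)) _) ⟩
    (size (applyUpTo (f ∘ suc) m) + weight (f 0)) + F 0
      ≡⟨ +-assoc (size (applyUpTo (f ∘ suc) m)) _ _ ⟩
    size (applyUpTo (f ∘ suc) m) + (weight (f 0) + F 0)
      ≡⟨ cong (size (applyUpTo (f ∘ suc) m) +_) (step 0) ⟩
    size (applyUpTo (f ∘ suc) m) + F 1             ≡⟨ telescope (f ∘ suc) (F ∘ suc) (step ∘ suc) m ⟩
    F (suc m)                                      ∎

  telescope-from : (f : ℕ → A) (F : ℕ → ℕ) → (∀ k → weight (f k) + F k ≡ F (suc k)) →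
                   ∀ s m → size (applyUpTo (λ i → f (s + i)) m) + F s ≡ F (s + m)
  telescope-from f F step s m = begin
    size window + F s       ≡⟨ cong (λ j → size window + F j) (sym (+-identityʳ s)) ⟩
    size window + F (s + 0) ≡⟨ telescope (λ i → f (s + i)) (λ i → F (s + i)) step′ m ⟩
    F (s + m)               ∎
    where
    window : List A
    window = applyUpTo (λ i → f (s + i)) m

    step′ : ∀ k → weight (f (s + k)) + F (s + k) ≡ F (s + suc k)
    step′ k = trans (step (s + k)) (cong F (sym (+-suc s k)))

prefixCount : RotorType → St → ℕ → ℕ
prefixCount r s zero    = 0
prefixCount r s (suc k) = count s [ seq r k ] + prefixCount r s k

prefixCount-sum : ∀ r k → prefixCount r one k + prefixCount r two k ≡ k
prefixCount-sum r zero = refl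
prefixCount-sum r (suc k) with seq r k
... | one = cong suc (prefixCount-sum r k)
... | two = trans (+-suc (prefixCount r one k) _) (cong suc (prefixCount-sum r k))

prefixCount-run : ∀ r x s m → count x (run r s m) + prefixCount r x s ≡ prefixCount r x (s + m)
prefixCount-run r x = telescope-from (seq r) (prefixCount r x) (λ _ → refl)
  where open Telescope (count x) (λ y → count x [ y ]) (count-[] x) (count-∷ x)

balanced-extend : ∀ r s m → prefixCount r one s ≡ prefixCount r two s → BalancedRun (run r s m) →
                  prefixCount r one (s + m) ≡ prefixCount r two (s + m)
balanced-extend r s m eq bal = begin
  prefixCount r one (s + m)                    ≡⟨ sym (prefixCount-run r one s m) ⟩
  count₁ (run r s m) + prefixCount r one s     ≡⟨ cong₂ _+_ bal eq ⟩
  count₂ (run r s m) + prefixCount r two s     ≡⟨ prefixCount-run r two s m ⟩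
  prefixCount r two (s + m)                    ∎

prefixCount-half : ∀ r {k} n → k ≡ 2 * n → prefixCount r one k ≡ prefixCount r two k →
                   ∀ x → prefixCount r x k ≡ n
prefixCount-half r {k} n k≡2n eq one = *-cancelˡ-≡ _ n 2 (begin
  2 * p₁                          ≡⟨ cong (p₁ +_) (+-identityʳ p₁) ⟩
  p₁ + p₁                         ≡⟨ cong (p₁ +_) eq ⟩
  p₁ + prefixCount r two k        ≡⟨ prefixCount-sum r k ⟩
  k                               ≡⟨ k≡2n ⟩
  2 * n                           ∎)
  where
  p₁ : ℕ
  p₁ = prefixCount r one k
prefixCount-half r n k≡2n eq two = trans (sym eq) (prefixCount-half r n k≡2n eq one)

countersBefore≡prefixCounts : ∀ r v k → countersBefore r v k ≡ (prefixCount r one k , prefixCount r two k)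
countersBefore≡prefixCounts r v zero = refl
countersBefore≡prefixCounts r v (suc k) rewrite countersBefore≡prefixCounts r v k with seq r k
... | one = refl
... | two = refl

exitState : Variant → St
exitState U = two
exitState D = one

toward : Target → St
toward t4 = one
toward t5 = two

-- Target t is hit exactly when the source rotor shows toward t and the rotor of the vertex
-- then reached shows exitState v.
hitsBefore : RotorType → Variant → Target → ℕ → ℕ
hitsBefore r v t k = prefixCount r (exitState v) (prefixCount r (toward t) k)

hits-step : ∀ r v t k →
  countHits t (fromMaybe (hit r v k)) + hitsBefore r v t k ≡ hitsBefore r v t (suc k)
hits-step r v t k rewrite countersBefore≡prefixCounts r v k with seq r k
hits-step r U t4 k | one with seq r (prefixCount r one k)
... | one = refl
... | two = refl
hits-step r U t4 k | two with seq r (prefixCount r two k)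
... | one = refl
... | two = refl
hits-step r U t5 k | one with seq r (prefixCount r one k)
... | one = refl
... | two = refl
hits-step r U t5 k | two with seq r (prefixCount r two k)
... | one = refl
... | two = refl
hits-step r D t4 k | one with seq r (prefixCount r one k)
... | one = refl
... | two = refl
hits-step r D t4 k | two with seq r (prefixCount r two k)
... | one = refl
... | two = refl
hits-step r D t5 k | one with seq r (prefixCount r one k)
... | one = refl
... | two = refl
hits-step r D t5 k | two with seq r (prefixCount r two k)
... | one = refl
... | two = refl

hitsBefore-hitRun : ∀ r v t s m →
  countHits t (hitRun r v s m) + hitsBefore r v t s ≡ hitsBefore r v t (s + m)
hitsBefore-hitRun r v t = telescope-from (λ k → k) (hitsBefore r v t) (hits-step r v t)
  where open Telescope (λ ks → countHits t (mapMaybe (hit r v) ks))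
                       (λ k → countHits t (fromMaybe (hit r v k)))
                       (countHits-[] t) (countHits-mapMaybe-∷ t (hit r v))

countHits-window : ∀ r a b → BalancedRun (run r 0 (2 * a)) → BalancedRun (run r (2 * a) (2 * b)) →
                   ∀ v t → countHits t (hitRun r v (2 * a) (2 * b)) ≡ count (exitState v) (run r a b)
countHits-window r a b bal₀ bal₁ v t = +-cancelʳ-≡ (prefixCount r e a) _ _ (begin
  hits + prefixCount r e a                ≡⟨ cong (λ j → hits + prefixCount r e j) (sym (half₀ (toward t))) ⟩
  hits + hitsBefore r v t (2 * a)         ≡⟨ hitsBefore-hitRun r v t (2 * a) (2 * b) ⟩
  hitsBefore r v t (2 * a + 2 * b)        ≡⟨ cong (prefixCount r e) (half₁ (toward t)) ⟩
  prefixCount r e (a + b)                 ≡⟨ sym (prefixCount-run r e a b) ⟩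
  count e (run r a b) + prefixCount r e a ∎)
  where
  e : St
  e = exitState v
  hits : ℕ
  hits = countHits t (hitRun r v (2 * a) (2 * b))
  eq₀ : prefixCount r one (2 * a) ≡ prefixCount r two (2 * a)
  eq₀ = balanced-extend r 0 (2 * a) refl bal₀
  half₀ : ∀ x → prefixCount r x (2 * a) ≡ a
  half₀ = prefixCount-half r a refl eq₀
  half₁ : ∀ x → prefixCount r x (2 * a + 2 * b) ≡ a + b
  half₁ = prefixCount-half r (a + b) (sym (*-distribˡ-+ 2 a b)) (balanced-extend r (2 * a) (2 * b) eq₀ bal₁)

theorem7p7 : (r : RotorType) → BalancedType r → (a b : ℕ) → b ≥ 1 →
    BalancedRun (run r 0 (2 * a)) → BalancedRun (run r (2 * a) (2 * b)) →
    (¬ ConstantRun (run r a b) →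
        hitRun r U (2 * a) (2 * b) ≢ [] × hitRun r D (2 * a) (2 * b) ≢ [] ×
        BalancedHits (hitRun r U (2 * a) (2 * b)) × BalancedHits (hitRun r D (2 * a) (2 * b)) ×
        length (hitRun r U (2 * a) (2 * b)) + length (hitRun r D (2 * a) (2 * b)) ≡ 2 * b)
    ×
    (ConstantRun (run r a b) →
        (hitRun r U (2 * a) (2 * b) ≢ [] × hitRun r D (2 * a) (2 * b) ≡ [] ×
          BalancedHits (hitRun r U (2 * a) (2 * b)) × length (hitRun r U (2 * a) (2 * b)) ≡ 2 * b)
        ⊎
        (hitRun r U (2 * a) (2 * b) ≡ [] × hitRun r D (2 * a) (2 * b) ≢ [] ×
          BalancedHits (hitRun r D (2 * a) (2 * b)) × length (hitRun r D (2 * a) (2 * b)) ≡ 2 * b))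
theorem7p7 r _ a b b≥1 bal₀ bal₁ =
  (λ ¬const →
    nonempty-of-length (lengths U) (λ u≡0 → ¬const (one , All-count-flip one window u≡0)) ,
    nonempty-of-length (lengths D) (λ d≡0 → ¬const (two , All-count-flip two window d≡0)) ,
    balanced U , balanced D , trans (cong₂ _+_ (lengths U) (lengths D)) total) ,
  λ { (one , all) → inj₂ (empty-of-length (lengths U) (count-flip-All one all) ,
                          nonempty-of-length (lengths D) (count-window≢0 one all) ,
                          balanced D , trans (lengths D) (cong (2 *_) (count-window one all)))
    ; (two , all) → inj₁ (nonempty-of-length (lengths U) (count-window≢0 two all) ,
                          empty-of-length (lengths D) (count-flip-All two all) ,
                          balanced U , trans (lengths U) (cong (2 *_) (count-window two all))) }
  where
  window : List St
  window = run r a b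
  hits : Variant → List Target
  hits v = hitRun r v (2 * a) (2 * b)
  profile : ∀ v → BalancedHits (hits v) × length (hits v) ≡ 2 * count (exitState v) window
  profile v = balancedHits-length (hits v) (countHits-window r a b bal₀ bal₁ v t4)
                                           (countHits-window r a b bal₀ bal₁ v t5)
  balanced : ∀ v → BalancedHits (hits v)
  balanced v = proj₁ (profile v)
  lengths : ∀ v → length (hits v) ≡ 2 * count (exitState v) window
  lengths v = proj₂ (profile v)
  count-window : ∀ s → All (_≡ s) window → count s window ≡ b
  count-window s all = trans (count-All s all) (length-applyUpTo _ b)
  count-window≢0 : ∀ s → All (_≡ s) window → count s window ≢ 0
  count-window≢0 s all = m<n⇒n≢0 (subst (1 ≤_) (sym (count-window s all)) b≥1)
  total : 2 * count₂ window + 2 * count₁ window ≡ 2 * b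
  total = begin
    2 * count₂ window + 2 * count₁ window  ≡⟨ sym (*-distribˡ-+ 2 (count₂ window) _) ⟩
    2 * (count₂ window + count₁ window)    ≡⟨ cong (2 *_) (+-comm (count₂ window) _) ⟩
    2 * (count₁ window + count₂ window)    ≡⟨ cong (2 *_) (count₁+count₂≡length window) ⟩
    2 * length window                      ≡⟨ cong (2 *_) (length-applyUpTo _ b) ⟩
    2 * b                                  ∎
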